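{- Let $G=(V,E)$ be a simple directed graph with integer edge weights $w:E\to\{1,\dots,U\}$ and root $r\in V$, and let $\lambda$ be the weight of a minimum $r$-cut. Let $k$ be the minimum number of vertices in a sink component of a minimum $r$-cut. Then either $k=1$ or $\lambda<Uk$.
   Context: For a nonempty set $T\subseteq V\setminus\{r\}$, the $r$-cut with sink component $T$ is the set $\delta^-(T)$ of edges with tail outside $T$ and head in $T$, of weight $w(\delta^-(T))=\sum_{e\in\delta^-(T)}w(e)$; a minimum $r$-cut is one of minimum weight, and its weight is $\lambda$. -}

module Defs where

open import Data.Nat using (ℕ; _≤_)
open import Data.Bool using (Bool; true; false; _∧_; not; if_then_else_)
open import Data.Fin using (Fin)
open import Data.List using (map; allFin)
open import Data.Nat.ListAction using (sum)
open import Data.Vec using (lookup)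
open import Data.Fin.Subset using (Subset; _∉_; Nonempty; ∣_∣)
open import Data.Product using (Σ; _×_)
open import Relation.Binary.PropositionalEquality using (_≡_)

-- A weighted simple directed graph on vertex set Fin n:
-- adj u v = true iff (u , v) is an edge; w u v is its weight (only meaningful on edges).
record WDigraph (n : ℕ) : Set where
  field
    adj : Fin n → Fin n → Bool
    w   : Fin n → Fin n → ℕ

open WDigraph public

-- simple: no self-loops (at most one edge per ordered pair is built in)
Loopless : ∀ {n} → WDigraph n → Set
Loopless G = ∀ v → adj G v v ≡ false

WeightsIn : ∀ {n} → WDigraph n → ℕ → Set
WeightsIn G U = ∀ u v → adj G u v ≡ true → (1 ≤ w G u v) × (w G u v ≤ U)

cutWeight : ∀ {n} → WDigraph n → Subset n → ℕ
cutWeight {n} G T =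
  sum (map (λ u → sum (map (λ v →
        if not (lookup T u) ∧ lookup T v ∧ adj G u v then w G u v else 0)
      (allFin n))) (allFin n))

IsSinkSet : ∀ {n} → Fin n → Subset n → Set
IsSinkSet r T = Nonempty T × r ∉ T

IsMinCutValue : ∀ {n} → WDigraph n → Fin n → ℕ → Set
IsMinCutValue G r λ′ =
  Σ _ (λ T → IsSinkSet r T × cutWeight G T ≡ λ′)
  × (∀ T → IsSinkSet r T → λ′ ≤ cutWeight G T)

IsMinCut : ∀ {n} → WDigraph n → Fin n → Subset n → Set
IsMinCut G r T = IsSinkSet r T × (∀ T′ → IsSinkSet r T′ → cutWeight G T ≤ cutWeight G T′)

IsMinSinkSize : ∀ {n} → WDigraph n → Fin n → ℕ → Set
IsMinSinkSize G r k =
  Σ _ (λ T → IsMinCut G r T × ∣ T ∣ ≡ k)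
  × (∀ T → IsMinCut G r T → k ≤ ∣ T ∣)

-- Suppose k ≥ 2 and let T be a minimum sink component with |T| = k. For v ∈ T the
-- singleton {v} is a sink set smaller than k, so it is not a minimum cut and
-- w(δ⁻({v})) ≥ λ + 1. Summing over v ∈ T counts each edge of δ⁻(T) once and each edge
-- inside T at most once; there are at most k(k − 1) of the latter, each of weight ≤ U.
-- Hence k(λ + 1) ≤ λ + U k (k − 1), i.e. (k − 1) λ + k ≤ (k − 1) U k, so λ < U k.
module Submission where

open import Defs
open import Data.Nat.Properties hiding (_≟_)
open import Algebra.Properties.Semiring.Sum +-*-semiring
  using (sum-cong-≗; sum-remove; sum-replicate-zero; ∑-distrib-+; ∑-comm; *-distribʳ-sum)
  renaming (sum to ∑)
open import Data.Bool using (Bool; true; false; _∧_; not; if_then_else_)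
open import Data.Bool.Properties using (∧-zeroʳ)
open import Data.Fin using (Fin; _≟_; punchIn) renaming (zero to fzero; suc to fsuc)
open import Data.Fin.Properties using (punchInᵢ≢i)
open import Data.Fin.Subset using (Subset; ⁅_⁆; _-_; ∣_∣; _∈_; _∉_)
open import Data.Fin.Subset.Properties
  using (x∈⁅x⁆; x∈⁅y⁆⇒x≡y; x≢y⇒x∉⁅y⁆; x∈p∧x≢y⇒x∈p-y; x∈p⇒∣p-x∣<∣p∣; ∣⁅x⁆∣≡1)
open import Data.List using (map; allFin; tabulate)
open import Data.List.Properties using (map-tabulate)
open import Data.Nat using (ℕ; zero; suc; _+_; _*_; _≤_; _<_; z≤n; s≤s; z<s; _<?_)
open import Data.Nat.ListAction using (sum)
open import Data.Nat.Solver using (module +-*-Solver)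
open import Data.Product using (_,_; proj₂)
open import Data.Sum using (_⊎_; inj₁; inj₂)
open import Data.Vec using (lookup; []; _∷_)
open import Data.Vec.Properties using ([]=⇒lookup; lookup⇒[]=)
open import Function using (_∘_)
open import Relation.Nullary using (yes; no; contradiction)
open import Relation.Binary.PropositionalEquality

private
  variable
    n : ℕ

sum-map-allFin : (f : Fin n → ℕ) → sum (map f (allFin n)) ≡ ∑ f
sum-map-allFin {n} f = trans (cong sum (map-tabulate (λ i → i) f)) (sum-tabulate f)
  where
  sum-tabulate : ∀ {m} (g : Fin m → ℕ) → sum (tabulate g) ≡ ∑ g
  sum-tabulate {zero} g = refl
  sum-tabulate {suc m} g = cong (g fzero +_) (sum-tabulate (g ∘ fsuc))

∑-mono-≤ : {f g : Fin n → ℕ} → (∀ i → f i ≤ g i) → ∑ f ≤ ∑ g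
∑-mono-≤ {zero} f≤g = z≤n
∑-mono-≤ {suc n} f≤g = +-mono-≤ (f≤g fzero) (∑-mono-≤ (f≤g ∘ fsuc))

∑-single : (f : Fin n → ℕ) (j : Fin n) → (∀ i → i ≢ j → f i ≡ 0) → ∑ f ≡ f j
∑-single {suc n} f j vanish = begin
  ∑ f                           ≡⟨ sum-remove {i = j} f ⟩
  f j + ∑ (f ∘ punchIn j)       ≡⟨ cong (f j +_) (sum-cong-≗ (λ i → vanish (punchIn j i) (punchInᵢ≢i j i))) ⟩
  f j + ∑ {n} (λ _ → 0)         ≡⟨ cong (f j +_) (sum-replicate-zero n) ⟩
  f j + 0                       ≡⟨ +-identityʳ (f j) ⟩
  f j                           ∎
  where open ≡-Reasoning

𝟙 : Bool → ℕ
𝟙 true  = 1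
𝟙 false = 0

∉⇒lookup≡false : {p : Subset n} {x : Fin n} → x ∉ p → lookup p x ≡ false
∉⇒lookup≡false {p = p} {x} x∉p with lookup p x in eq
... | true  = contradiction (lookup⇒[]= x p eq) x∉p
... | false = refl

lookup≡false⇒∉ : {p : Subset n} {x : Fin n} → lookup p x ≡ false → x ∉ p
lookup≡false⇒∉ eq x∈p with () ← trans (sym ([]=⇒lookup x∈p)) eq

∣p∣≡∑𝟙 : (p : Subset n) → ∣ p ∣ ≡ ∑ (𝟙 ∘ lookup p)
∣p∣≡∑𝟙 []          = refl
∣p∣≡∑𝟙 (true ∷ p)  = cong suc (∣p∣≡∑𝟙 p)
∣p∣≡∑𝟙 (false ∷ p) = ∣p∣≡∑𝟙 p

∑∈ : Subset n → (Fin n → ℕ) → ℕ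
∑∈ p f = ∑ (λ v → 𝟙 (lookup p v) * f v)

∑∈-const : (p : Subset n) (a : ℕ) → ∑∈ p (λ _ → a) ≡ ∣ p ∣ * a
∑∈-const p a = sym (trans (cong (_* a) (∣p∣≡∑𝟙 p)) (*-distribʳ-sum a (𝟙 ∘ lookup p)))

∑∈-+ : (p : Subset n) (f g : Fin n → ℕ) → ∑∈ p (λ v → f v + g v) ≡ ∑∈ p f + ∑∈ p g
∑∈-+ p f g = trans (sum-cong-≗ (λ v → *-distribˡ-+ (𝟙 (lookup p v)) (f v) (g v)))
                   (∑-distrib-+ (λ v → 𝟙 (lookup p v) * f v) (λ v → 𝟙 (lookup p v) * g v))

∑∈-mono-≤ : (p : Subset n) {f g : Fin n → ℕ} → (∀ v → v ∈ p → f v ≤ g v) → ∑∈ p f ≤ ∑∈ p g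
∑∈-mono-≤ p {f} {g} f≤g = ∑-mono-≤ pointwise
  where
  pointwise : ∀ v → 𝟙 (lookup p v) * f v ≤ 𝟙 (lookup p v) * g v
  pointwise v with lookup p v in eq
  ... | true  = +-monoˡ-≤ 0 (f≤g v (lookup⇒[]= v p eq))
  ... | false = z≤n

∑∈-supported : (p : Subset n) (f : Fin n → ℕ) → (∀ v → v ∉ p → f v ≡ 0) → ∑∈ p f ≡ ∑ f
∑∈-supported p f vanish = sum-cong-≗ pointwise
  where
  pointwise : ∀ v → 𝟙 (lookup p v) * f v ≡ f v
  pointwise v with lookup p v in eq
  ... | true  = +-identityʳ (f v)
  ... | false = sym (vanish v (lookup≡false⇒∉ eq))

enteringWeight : WDigraph n → Subset n → Fin n → Fin n → ℕ
enteringWeight G T u v = if not (lookup T u) ∧ lookup T v ∧ adj G u v then w G u v else 0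

cutWeightAt : WDigraph n → Subset n → Fin n → ℕ
cutWeightAt G T v = ∑ (λ u → enteringWeight G T u v)

cutWeight≡∑cutWeightAt : (G : WDigraph n) (T : Subset n) → cutWeight G T ≡ ∑ (cutWeightAt G T)
cutWeight≡∑cutWeightAt {n} G T = begin
  cutWeight G T                                          ≡⟨ sum-map-allFin inner ⟩
  ∑ inner                                                ≡⟨ sum-cong-≗ (sum-map-allFin ∘ enteringWeight G T) ⟩
  ∑ (λ u → ∑ (enteringWeight G T u))                     ≡⟨ ∑-comm (enteringWeight G T) ⟩
  ∑ (cutWeightAt G T)                                    ∎
  where
  open ≡-Reasoning
  inner : Fin n → ℕ
  inner u = sum (map (enteringWeight G T u) (allFin n))

cutWeightAt-∉ : (G : WDigraph n) {T : Subset n} {v : Fin n} → v ∉ T → cutWeightAt G T v ≡ 0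
cutWeightAt-∉ {n} G {T} {v} v∉T = trans (sum-cong-≗ noEdge) (sum-replicate-zero n)
  where
  noEdge : ∀ u → enteringWeight G T u v ≡ 0
  noEdge u rewrite ∉⇒lookup≡false v∉T | ∧-zeroʳ (not (lookup T u)) = refl

cutWeight-⁅⁆ : (G : WDigraph n) (v : Fin n) → cutWeight G ⁅ v ⁆ ≡ cutWeightAt G ⁅ v ⁆ v
cutWeight-⁅⁆ G v = trans (cutWeight≡∑cutWeightAt G ⁅ v ⁆)
  (∑-single (cutWeightAt G ⁅ v ⁆) v (λ x x≢v → cutWeightAt-∉ G (x≢y⇒x∉⁅y⁆ x≢v)))

enteringWeight-⁅⁆≤ : {G : WDigraph n} {U : ℕ} {T : Subset n} {v : Fin n} →
  WeightsIn G U → v ∈ T → ∀ u →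
  enteringWeight G ⁅ v ⁆ u v ≤ enteringWeight G T u v + 𝟙 (lookup (T - v) u) * U
enteringWeight-⁅⁆≤ {G = G} {U} {T} {v} weights v∈T u with u ≟ v
... | yes refl rewrite []=⇒lookup (x∈⁅x⁆ v) = z≤n
... | no u≢v rewrite []=⇒lookup (x∈⁅x⁆ v) | ∉⇒lookup≡false (x≢y⇒x∉⁅y⁆ u≢v) | []=⇒lookup v∈T
  with lookup T u in u∈T
...   | false = m≤m+n _ _
...   | true rewrite []=⇒lookup (x∈p∧x≢y⇒x∈p-y (lookup⇒[]= u T u∈T) u≢v) with adj G u v in uv
...     | true  = subst (w G u v ≤_) (sym (+-identityʳ U)) (proj₂ (weights u v uv))
...     | false = z≤n

cutWeight-⁅⁆≤ : {G : WDigraph n} {U : ℕ} {T : Subset n} {v : Fin n} →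
  WeightsIn G U → v ∈ T → cutWeight G ⁅ v ⁆ ≤ cutWeightAt G T v + ∣ T - v ∣ * U
cutWeight-⁅⁆≤ {G = G} {U} {T} {v} weights v∈T = begin
  cutWeight G ⁅ v ⁆                                   ≡⟨ cutWeight-⁅⁆ G v ⟩
  cutWeightAt G ⁅ v ⁆ v                               ≤⟨ ∑-mono-≤ (enteringWeight-⁅⁆≤ weights v∈T) ⟩
  ∑ (λ u → enteringWeight G T u v + 𝟙 (lookup (T - v) u) * U)
    ≡⟨ ∑-distrib-+ (λ u → enteringWeight G T u v) (λ u → 𝟙 (lookup (T - v) u) * U) ⟩
  cutWeightAt G T v + ∑∈ (T - v) (λ _ → U)            ≡⟨ cong (cutWeightAt G T v +_) (∑∈-const (T - v) U) ⟩
  cutWeightAt G T v + ∣ T - v ∣ * U                   ∎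
  where open ≤-Reasoning

∑∈-cutWeight-⁅⁆≤ : {G : WDigraph n} {U m : ℕ} (T : Subset n) →
  WeightsIn G U → ∣ T ∣ ≡ suc m →
  ∑∈ T (λ v → cutWeight G ⁅ v ⁆) ≤ cutWeight G T + ∣ T ∣ * (m * U)
∑∈-cutWeight-⁅⁆≤ {G = G} {U} {m} T weights ∣T∣≡1+m = begin
  ∑∈ T (λ v → cutWeight G ⁅ v ⁆)                       ≤⟨ ∑∈-mono-≤ T singletonBound ⟩
  ∑∈ T (λ v → cutWeightAt G T v + m * U)               ≡⟨ ∑∈-+ T (cutWeightAt G T) (λ _ → m * U) ⟩
  ∑∈ T (cutWeightAt G T) + ∑∈ T (λ _ → m * U)
    ≡⟨ cong₂ _+_ (∑∈-supported T (cutWeightAt G T) (λ v → cutWeightAt-∉ G))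
                 (∑∈-const T (m * U)) ⟩
  ∑ (cutWeightAt G T) + ∣ T ∣ * (m * U)                ≡⟨ cong (_+ ∣ T ∣ * (m * U)) (sym (cutWeight≡∑cutWeightAt G T)) ⟩
  cutWeight G T + ∣ T ∣ * (m * U)                      ∎
  where
  open ≤-Reasoning
  singletonBound : ∀ v → v ∈ T → cutWeight G ⁅ v ⁆ ≤ cutWeightAt G T v + m * U
  singletonBound v v∈T = ≤-trans (cutWeight-⁅⁆≤ weights v∈T)
    (+-monoʳ-≤ (cutWeightAt G T v) (*-monoˡ-≤ U ∣T-v∣≤m))
    where
    ∣T-v∣≤m : ∣ T - v ∣ ≤ m
    ∣T-v∣≤m = ≤-pred (subst (∣ T - v ∣ <_) ∣T∣≡1+m (x∈p⇒∣p-x∣<∣p∣ v∈T))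

averaging-< : ∀ m c U → suc (suc m) * suc c ≤ c + suc (suc m) * (suc m * U) → c < U * suc (suc m)
averaging-< m c U hyp = *-cancelˡ-< (suc m) c (U * k) (begin-strict
  suc m * c          <⟨ m<m+n (suc m * c) z<s ⟩
  suc m * c + k      ≤⟨ +-cancelˡ-≤ c _ _ (subst₂ _≤_ lhs rhs hyp) ⟩
  suc m * (U * k)    ∎)
  where
  open ≤-Reasoning
  open +-*-Solver
  k : ℕ
  k = suc (suc m)
  lhs : k * suc c ≡ c + (suc m * c + k)
  lhs = solve 2 (λ m c → (con 2 :+ m) :* (con 1 :+ c) := c :+ ((con 1 :+ m) :* c :+ (con 2 :+ m))) refl m c
  rhs : c + k * (suc m * U) ≡ c + suc m * (U * k)
  rhs = solve 3 (λ m c U → c :+ (con 2 :+ m) :* ((con 1 :+ m) :* U) := c :+ (con 1 :+ m) :* (U :* (con 2 :+ m))) refl m c U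

module _ {G : WDigraph n} {r : Fin n} {λ′ : ℕ} where

  minCut-cutWeight : {T : Subset n} → IsMinCutValue G r λ′ → IsMinCut G r T → cutWeight G T ≡ λ′
  minCut-cutWeight {T} ((T₀ , T₀-sink , T₀-cut) , λ′-min) (T-sink , T-min) =
    ≤-antisym (subst (cutWeight G T ≤_) T₀-cut (T-min T₀ T₀-sink)) (λ′-min T T-sink)

  smallSink-cutWeight : {k : ℕ} {S : Subset n} → IsMinCutValue G r λ′ → IsMinSinkSize G r k →
    IsSinkSet r S → ∣ S ∣ < k → λ′ < cutWeight G S
  smallSink-cutWeight {S = S} (_ , λ′-min) (_ , k-min) S-sink ∣S∣<k with λ′ <? cutWeight G S
  ... | yes λ′<cut = λ′<cut
  ... | no  λ′≮cut = contradiction (k-min S S-isMinCut) (<⇒≱ ∣S∣<k)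
    where
    S-isMinCut : IsMinCut G r S
    S-isMinCut = S-sink , λ S′ S′-sink → ≤-trans (≮⇒≥ λ′≮cut) (λ′-min S′ S′-sink)

⁅⁆-isSinkSet : {r v : Fin n} {T : Subset n} → IsSinkSet r T → v ∈ T → IsSinkSet r ⁅ v ⁆
⁅⁆-isSinkSet {v = v} {T} (_ , r∉T) v∈T =
  (v , x∈⁅x⁆ v) , λ r∈⁅v⁆ → r∉T (subst (_∈ T) (sym (x∈⁅y⁆⇒x≡y v r∈⁅v⁆)) v∈T)

minCutValue<U*minSinkSize : {G : WDigraph n} {U : ℕ} {r : Fin n} {λ′ m : ℕ} →
  WeightsIn G U → IsMinCutValue G r λ′ → IsMinSinkSize G r (suc (suc m)) → λ′ < U * suc (suc m)
minCutValue<U*minSinkSize {G = G} {U} {λ′ = λ′} {m} weights minValue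
  minSize@((T , T-minCut@(T-sink , _) , ∣T∣≡k) , _) = averaging-< m λ′ U (begin
  suc (suc m) * suc λ′                 ≡⟨ cong (_* suc λ′) ∣T∣≡k ⟨
  ∣ T ∣ * suc λ′                       ≡⟨ ∑∈-const T (suc λ′) ⟨
  ∑∈ T (λ _ → suc λ′)                  ≤⟨ ∑∈-mono-≤ T singletonCut> ⟩
  ∑∈ T (λ v → cutWeight G ⁅ v ⁆)       ≤⟨ ∑∈-cutWeight-⁅⁆≤ T weights ∣T∣≡k ⟩
  cutWeight G T + ∣ T ∣ * (suc m * U)  ≡⟨ cong₂ (λ a b → a + b * (suc m * U)) (minCut-cutWeight minValue T-minCut) ∣T∣≡k ⟩
  λ′ + suc (suc m) * (suc m * U)       ∎)
  where
  open ≤-Reasoning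
  singletonCut> : ∀ v → v ∈ T → suc λ′ ≤ cutWeight G ⁅ v ⁆
  singletonCut> v v∈T = smallSink-cutWeight minValue minSize (⁅⁆-isSinkSet T-sink v∈T)
    (subst (_< suc (suc m)) (sym (∣⁅x⁆∣≡1 v)) (s≤s z<s))

lemma2p2 : (n : ℕ) (G : WDigraph n) (U : ℕ) (r : Fin n) (λ′ k : ℕ)
    → Loopless G → WeightsIn G U
    → IsMinCutValue G r λ′ → IsMinSinkSize G r k
    → (k ≡ 1) ⊎ (λ′ < U * k)
-- A loop never crosses a cut.
lemma2p2 n G U r λ′ zero _ _ _ ((T , (((x , x∈T) , _) , _) , ∣T∣≡0) , _) =
  contradiction (subst (∣ T - x ∣ <_) ∣T∣≡0 (x∈p⇒∣p-x∣<∣p∣ x∈T)) λ ()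
lemma2p2 n G U r λ′ (suc zero)    _ _       _        _       = inj₁ refl
lemma2p2 n G U r λ′ (suc (suc m)) _ weights minValue minSize =
  inj₂ (minCutValue<U*minSinkSize weights minValue minSize)
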